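{- Let $G$ and $H$ be graphs with $\mathrm{oh}(G)=s$ and $\mathrm{oh}(H)=t$. Then $\mathrm{oh}(G \ast H) \geq \mathrm{oh}(K_s \ast K_t)$, where $\ast$ is any one of the Cartesian product $\square$, the lexicographic product, or the strong product $\boxtimes$.
   Context: All graphs are finite, simple and loopless. For graphs $G$ and $H$, the Odd Hadwiger number $\mathrm{oh}(G)$ is the largest integer $m$ such that $G$ contains $K_m$ as an odd minor; equivalently, the largest $m$ for which there exist $m$ pairwise vertex-disjoint trees $Z_1,\dots,Z_m$ (subgraphs of $G$) and a 2-colouring $c$ of $V(Z_1)\cup\dots\cup V(Z_m)$ such that $c$ is a proper colouring of each $Z_k$, and for every pair $k\neq k'$ there is an edge $xy\in E(G)$ with $x\in V(Z_k)$, $y\in V(Z_{k'})$ and $c(x)=c(y)$. Products all have vertex set $V(G)\times V(H)$. Cartesian product $G\square H$: $(v_1,u_1)\sim(v_2,u_2)$ iff ($v_1=v_2$ and $u_1u_2\in E(H)$) or ($u_1=u_2$ and $v_1v_2\in E(G)$). Lexicographic product: $(v_1,u_1)\sim(v_2,u_2)$ iff $v_1v_2\in E(G)$, or ($v_1=v_2$ and $u_1u_2\in E(H)$). Strong product $G\boxtimes H$: $(v_1,u_1)\sim(v_2,u_2)$ iff they are adjacent in $G\square H$ or ($v_1v_2\in E(G)$ and $u_1u_2\in E(H)$). -}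

module Defs where

open import Data.Nat using (ℕ; _≤_)
open import Data.Fin using (Fin)
open import Data.Bool using (Bool)
open import Data.Product using (Σ; ∃; _×_; _,_)
open import Data.Sum using (_⊎_)
open import Data.List using (List; []; _∷_; [_])
open import Data.List.Membership.Propositional using (_∈_; _∉_)
open import Relation.Binary.PropositionalEquality using (_≡_; _≢_)
open import Relation.Nullary using (¬_)

-- A finite simple loopless graph on vertex type V (V will always be a
-- finite type: Fin n, or a product of such).  Adjacency is a symmetric,
-- irreflexive relation.
record Graph (V : Set) : Set₁ where
  field
    Adj    : V → V → Set
    sym    : ∀ {x y} → Adj x y → Adj y x
    irrefl : ∀ {x} → ¬ Adj x x
open Graph public

K : (s : ℕ) → Graph (Fin s)
K s = record { Adj = λ i j → i ≢ j ; sym = λ p q → p (Eq.sym q) ; irrefl = λ p → p Eq.refl }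
  where open import Relation.Binary.PropositionalEquality as Eq

module _ {V W : Set} (G : Graph V) (H : Graph W) where
  open import Relation.Binary.PropositionalEquality as Eq

  cartesian : Graph (V × W)
  cartesian = record
    { Adj = λ { (v₁ , u₁) (v₂ , u₂) →
        (v₁ ≡ v₂ × Adj H u₁ u₂) ⊎ (u₁ ≡ u₂ × Adj G v₁ v₂) }
    ; sym = λ { (Data.Sum.inj₁ (e , a)) → Data.Sum.inj₁ (Eq.sym e , Graph.sym H a)
              ; (Data.Sum.inj₂ (e , a)) → Data.Sum.inj₂ (Eq.sym e , Graph.sym G a) }
    ; irrefl = λ { (Data.Sum.inj₁ (_ , a)) → Graph.irrefl H a
                 ; (Data.Sum.inj₂ (_ , a)) → Graph.irrefl G a } }

  lexicographic : Graph (V × W)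
  lexicographic = record
    { Adj = λ { (v₁ , u₁) (v₂ , u₂) →
        Adj G v₁ v₂ ⊎ (v₁ ≡ v₂ × Adj H u₁ u₂) }
    ; sym = λ { (Data.Sum.inj₁ a) → Data.Sum.inj₁ (Graph.sym G a)
              ; (Data.Sum.inj₂ (e , a)) → Data.Sum.inj₂ (Eq.sym e , Graph.sym H a) }
    ; irrefl = λ { (Data.Sum.inj₁ a) → Graph.irrefl G a
                 ; (Data.Sum.inj₂ (_ , a)) → Graph.irrefl H a } }

  strong : Graph (V × W)
  strong = record
    { Adj = λ x y → Adj cartesian x y ⊎ (Adj G (Data.Product.proj₁ x) (Data.Product.proj₁ y)
                                          × Adj H (Data.Product.proj₂ x) (Data.Product.proj₂ y))
    ; sym = λ { (Data.Sum.inj₁ a) → Data.Sum.inj₁ (Graph.sym cartesian a)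
              ; (Data.Sum.inj₂ (a , b)) → Data.Sum.inj₂ (Graph.sym G a , Graph.sym H b) }
    ; irrefl = λ { (Data.Sum.inj₁ a) → Graph.irrefl cartesian a
                 ; (Data.Sum.inj₂ (a , _)) → Graph.irrefl G a } }

data ProductKind : Set where
  □ lex ⊠ : ProductKind

_⟨_⟩_ : {V W : Set} → Graph V → ProductKind → Graph W → Graph (V × W)
G ⟨ □ ⟩ H = cartesian G H
G ⟨ lex ⟩ H = lexicographic G H
G ⟨ ⊠ ⟩ H = strong G H

data IsTree {V : Set} (G : Graph V) : List V → List (V × V) → Set where
  single : (v : V) → IsTree G [ v ] []
  leaf   : ∀ {vs es} {u w : V} → IsTree G vs es → u ∈ vs → w ∉ vs →
           Adj G u w → IsTree G (w ∷ vs) ((u , w) ∷ es)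

record OddMinorK {V : Set} (G : Graph V) (m : ℕ) : Set where
  field
    verts    : Fin m → List V
    edges    : Fin m → List (V × V)
    isTree   : ∀ k → IsTree G (verts k) (edges k)
    disjoint : ∀ k k' → k ≢ k' → ∀ x → x ∈ verts k → x ∉ verts k'
    colour   : V → Bool
    proper   : ∀ k u w → (u , w) ∈ edges k → colour u ≢ colour w
    oddEdge  : ∀ k k' → k ≢ k' →
               Σ V λ x → Σ V λ y → x ∈ verts k × y ∈ verts k' ×
                 Adj G x y × colour x ≡ colour y

IsOh : {V : Set} → Graph V → ℕ → Set
IsOh G s = OddMinorK G s × (∀ m → OddMinorK G m → m ≤ s)

{-# OPTIONS --safe #-}
module Submission where

-- Take odd models of K_s in G and K_t in H with colourings c_G and c_H.  For branch sets Z_i of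
-- G and Y_j of H, the set Z_i × Y_j carries a spanning tree of G □ H (a copy of Y_j over each
-- vertex of Z_i, linked by a copy of the tree on Z_i), properly coloured by
-- c (v , u) = c_G v xor c_H u.  The monochromatic edges between the Z_i, resp. the Y_j, give
-- monochromatic edges between the sets Z_i × Y_j whenever (i , j) and (i' , j') are adjacent in
-- K_s ∗ K_t (in the lexicographic product with i ≠ i', a G-edge between Z_i and Z_i' is paired
-- with equally coloured vertices of Y_j and Y_j', which exist as K_t is complete).  So K_s ∗ K_t
-- is an odd minor of G ∗ H, and odd minors compose: substitute these branch sets into an odd
-- model of K_r in K_s ∗ K_t, flipping c on those sets whose vertex is coloured true in the outer
-- model.

open import Defs
open import Data.Nat using (ℕ)
open import Data.Fin using (Fin)
import Data.Fin as Fin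
open import Data.Fin.Properties using (any?)
open import Data.Bool using (Bool; true; false; _xor_)
import Data.Bool.Properties as Bool
open import Data.Product using (∃; ∃₂; _×_; _,_; proj₁; proj₂)
import Data.Product as Product
open import Data.Product.Properties using (,-injectiveʳ; ≡-dec)
open import Data.Sum using (inj₁; inj₂)
open import Data.List using (List; _∷_; _++_; map; concatMap; cartesianProduct)
open import Data.List.Properties using (++-identityʳ)
open import Data.List.Membership.Propositional using (_∈_; _∉_; find; lose)
open import Data.List.Membership.Propositional.Properties
  using (∈-map⁺; ∈-map⁻; ∈-++⁺ˡ; ∈-++⁻; ∈-concatMap⁺; ∈-concatMap⁻; ∈-cartesianProduct⁺; ∈-cartesianProduct⁻)
open import Data.List.Relation.Unary.Any using (here; there)
import Data.List.Relation.Unary.Any as Any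
open import Data.List.Relation.Binary.Disjoint.Propositional using (Disjoint)
open import Data.List.Relation.Binary.Subset.Propositional using (_⊆_)
open import Data.List.Relation.Binary.Permutation.Propositional using (_↭_; ↭-refl; ↭-sym; ↭-trans; ↭-reflexive; prep)
open import Data.List.Relation.Binary.Permutation.Propositional.Properties using (∈-resp-↭; ++⁺ˡ; shift)
open import Data.Empty using (⊥-elim)
open import Function using (_∘_; id)
open import Function.Definitions using (Injective)
import Relation.Binary.PropositionalEquality as ≡
open ≡ using (_≡_; _≢_; refl; cong; cong₂; subst)
open import Relation.Binary.Definitions using (DecidableEquality)
open import Relation.Nullary using (yes; no)

xor-cancelˡ : ∀ c {a b} → c xor a ≡ c xor b → a ≡ b
xor-cancelˡ true  = Bool.not-injective
xor-cancelˡ false = id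

xor-cancelʳ : ∀ c {a b} → a xor c ≡ b xor c → a ≡ b
xor-cancelʳ c {a} {b} e = xor-cancelˡ c (≡.trans (Bool.xor-comm c a) (≡.trans e (Bool.xor-comm b c)))

bichromatic : {V : Set} → Graph V → (V → Bool) → Graph V
bichromatic G c = record
  { Adj    = λ x y → Adj G x y × c x ≢ c y
  ; sym    = λ (a , d) → sym G a , d ∘ ≡.sym
  ; irrefl = λ (a , _) → irrefl G a
  }

record SpanningTree {V : Set} (G : Graph V) (L : List V) : Set where
  field
    vertices   : List V
    edges      : List (V × V)
    isTree     : IsTree G vertices edges
    ↭-vertices : vertices ↭ L

  ∈⁺ : ∀ {v} → v ∈ L → v ∈ vertices
  ∈⁺ = ∈-resp-↭ (↭-sym ↭-vertices)

  ∈⁻ : ∀ {v} → v ∈ vertices → v ∈ L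
  ∈⁻ = ∈-resp-↭ ↭-vertices
open SpanningTree

module _ {V : Set} {G : Graph V} where

  SpanningTree-↭ : ∀ {L L'} → L ↭ L' → SpanningTree G L → SpanningTree G L'
  SpanningTree-↭ L↭L' T = record
    { vertices = vertices T ; edges = edges T ; isTree = isTree T
    ; ↭-vertices = ↭-trans (↭-vertices T) L↭L' }

  IsTree-nonempty : ∀ {vs es} → IsTree G vs es → ∃ (_∈ vs)
  IsTree-nonempty (single v)     = v , here refl
  IsTree-nonempty (leaf _ _ _ _) = _ , here refl

  IsTree-mono : ∀ {G' : Graph V} {vs es} → (∀ {a b} → a ∈ vs → b ∈ vs → Adj G a b → Adj G' a b) →
                IsTree G vs es → IsTree G' vs es
  IsTree-mono G⊆G' (single v)       = single v
  IsTree-mono G⊆G' (leaf T u∈ w∉ a) =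
    leaf (IsTree-mono (λ a∈ b∈ → G⊆G' (there a∈) (there b∈)) T) u∈ w∉ (G⊆G' (there u∈) (here refl) a)

  -- Trees only grow by leaves, so the second tree is regrown from y': its newest leaf w is either y'
  -- itself (hang w on the first tree and join along the edge w u) or is re-attached after the join.
  IsTree-join : ∀ {vs₁ es₁ vs₂ es₂ y y'} → IsTree G vs₁ es₁ → IsTree G vs₂ es₂ → Disjoint vs₁ vs₂ →
                y ∈ vs₁ → y' ∈ vs₂ → Adj G y y' → SpanningTree G (vs₂ ++ vs₁)
  IsTree-join T₁ (single v) disj y∈ (here refl) a = record
    { vertices = v ∷ _ ; edges = _ ; isTree = leaf T₁ y∈ (λ v∈ → disj (v∈ , here refl)) a
    ; ↭-vertices = ↭-refl }
  IsTree-join {vs₁} T₁ (leaf {vs = vs₂} {w = w} T₂ u∈ w∉ a₂) disj y∈ (here refl) a =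
    SpanningTree-↭ (shift w vs₂ vs₁)
      (IsTree-join (leaf T₁ y∈ (λ w∈ → disj (w∈ , here refl)) a) T₂ disj′ (here refl) u∈ (sym G a₂))
    where
    disj′ : Disjoint (w ∷ vs₁) vs₂
    disj′ (here refl , w∈) = w∉ w∈
    disj′ (there z∈ , z∈₂) = disj (z∈ , there z∈₂)
  IsTree-join T₁ (leaf {vs = vs₂} {w = w} T₂ u∈ w∉ a₂) disj y∈ (there y'∈) a = record
    { vertices = w ∷ vertices R ; edges = _ ; isTree = leaf (isTree R) (∈⁺ R (∈-++⁺ˡ u∈)) w∉R a₂
    ; ↭-vertices = prep w (↭-vertices R) }
    where
    R = IsTree-join T₁ T₂ (λ (z∈₁ , z∈₂) → disj (z∈₁ , there z∈₂)) y∈ y'∈ a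
    w∉R : w ∉ vertices R
    w∉R w∈ with ∈-++⁻ vs₂ (∈⁻ R w∈)
    ... | inj₁ w∈₂ = w∉ w∈₂
    ... | inj₂ w∈₁ = disj (w∈₁ , here refl)

  SpanningTree-join : ∀ {L₁ vs₂ es₂ y y'} → SpanningTree G L₁ → IsTree G vs₂ es₂ → Disjoint L₁ vs₂ →
                      y ∈ L₁ → y' ∈ vs₂ → Adj G y y' → SpanningTree G (vs₂ ++ L₁)
  SpanningTree-join {vs₂ = vs₂} T₁ T₂ disj y∈ y'∈ a =
    SpanningTree-↭ (++⁺ˡ vs₂ (↭-vertices T₁))
      (IsTree-join (isTree T₁) T₂ (λ (z∈₁ , z∈₂) → disj (∈⁻ T₁ z∈₁ , z∈₂)) (∈⁺ T₁ y∈) y'∈ a)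

  IsTree-bichromatic : ∀ {c vs es} → IsTree G vs es → (∀ {u w} → (u , w) ∈ es → c u ≢ c w) →
                       IsTree (bichromatic G c) vs es
  IsTree-bichromatic (single v)       proper = single v
  IsTree-bichromatic (leaf T u∈ w∉ a) proper =
    leaf (IsTree-bichromatic T (proper ∘ there)) u∈ w∉ (a , proper (here refl))

  IsTree-bichromatic-proper : ∀ {c vs es} → IsTree (bichromatic G c) vs es →
                              ∀ {u w} → (u , w) ∈ es → c u ≢ c w
  IsTree-bichromatic-proper (leaf _ _ _ (_ , d)) (here refl) = d
  IsTree-bichromatic-proper (leaf T _ _ _)       (there e∈)  = IsTree-bichromatic-proper T e∈

IsTree-map : ∀ {V W : Set} {G : Graph V} {G' : Graph W} {f : V → W} {vs es} →
             Injective _≡_ _≡_ f → (∀ {a b} → Adj G a b → Adj G' (f a) (f b)) →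
             IsTree G vs es → IsTree G' (map f vs) (map (Product.map f f) es)
IsTree-map f-inj f-hom (single v) = single _
IsTree-map {f = f} f-inj f-hom (leaf {vs = vs} {w = w} T u∈ w∉ a) =
  leaf (IsTree-map f-inj f-hom T) (∈-map⁺ f u∈) fw∉ (f-hom a)
  where
  fw∉ : f w ∉ map f vs
  fw∉ fw∈ with ∈-map⁻ f fw∈
  ... | _ , x∈ , fw≡fx = w∉ (subst (_∈ vs) (≡.sym (f-inj fw≡fx)) x∈)

record MonochromaticEdge {V : Set} (G : Graph V) (c : V → Bool) (xs ys : List V) : Set where
  constructor monochromaticEdge
  field
    {from to}  : V
    from∈      : from ∈ xs
    to∈        : to ∈ ys
    adjacent   : Adj G from to
    sameColour : c from ≡ c to

MonochromaticEdge-mono : ∀ {V : Set} {G G' : Graph V} {c xs ys} → (∀ {a b} → Adj G a b → Adj G' a b) →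
                         MonochromaticEdge G c xs ys → MonochromaticEdge G' c xs ys
MonochromaticEdge-mono G⊆G' (monochromaticEdge x∈ y∈ a e) = monochromaticEdge x∈ y∈ (G⊆G' a) e

-- OddMinorK G m is the case A = K m.
record OddModel {X Y : Set} (A : Graph X) (B : Graph Y) : Set where
  field
    colour      : Y → Bool
    branch      : X → List Y
    branchEdges : X → List (Y × Y)
    branchTree  : ∀ x → IsTree (bichromatic B colour) (branch x) (branchEdges x)
    disjoint    : ∀ {x x'} → x ≢ x' → Disjoint (branch x) (branch x')
    oddEdge     : ∀ {x x'} → Adj A x x' → MonochromaticEdge B colour (branch x) (branch x')

module _ {V : Set} {G : Graph V} {m : ℕ} where

  OddMinorK⇒OddModel : OddMinorK G m → OddModel (K m) G
  OddMinorK⇒OddModel M = record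
    { colour      = M.colour
    ; branch      = M.verts
    ; branchEdges = M.edges
    ; branchTree  = λ k → IsTree-bichromatic (M.isTree k) (M.proper k _ _)
    ; disjoint    = λ k≢k' (z∈ , z∈') → M.disjoint _ _ k≢k' _ z∈ z∈'
    ; oddEdge     = λ k≢k' → let (_ , _ , x∈ , y∈ , a , e) = M.oddEdge _ _ k≢k' in monochromaticEdge x∈ y∈ a e
    }
    where module M = OddMinorK M

  OddModel⇒OddMinorK : OddModel (K m) G → OddMinorK G m
  OddModel⇒OddMinorK M = record
    { verts    = M.branch
    ; edges    = M.branchEdges
    ; isTree   = λ k → IsTree-mono (λ _ _ → proj₁) (M.branchTree k)
    ; disjoint = λ k k' k≢k' z z∈ z∈' → M.disjoint k≢k' (z∈ , z∈')
    ; colour   = M.colour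
    ; proper   = λ k u w → IsTree-bichromatic-proper (M.branchTree k)
    ; oddEdge  = λ k k' k≢k' → let monochromaticEdge x∈ y∈ a e = M.oddEdge k≢k' in _ , _ , x∈ , y∈ , a , e
    }
    where module M = OddModel M

module Composite {r : ℕ} {Y Z : Set} {A : Graph (Fin r)} {B : Graph Y} {C : Graph Z}
                 (_≟_ : DecidableEquality Z) (M : OddModel A B) (N : OddModel B C) where
  private
    module M = OddModel M
    module N = OddModel N
  open import Data.List.Membership.DecPropositional _≟_ using (_∈?_)

  -- M.colour y for the y, among the vertices in branch sets of M, whose branch set N.branch y
  -- contains z; false (a junk value) if there is none.
  hostColour : Z → Bool
  hostColour z with any? (λ x → Any.any? (λ y → z ∈? N.branch y) (M.branch x))
  ... | yes (_ , found) = M.colour (proj₁ (Any.satisfied found))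
  ... | no _            = false

  hostColour-correct : ∀ {x y z} → y ∈ M.branch x → z ∈ N.branch y → hostColour z ≡ M.colour y
  hostColour-correct {x} {y} {z} y∈ z∈ with any? (λ x → Any.any? (λ y → z ∈? N.branch y) (M.branch x))
  ... | no none = ⊥-elim (none (x , lose y∈ z∈))
  ... | yes (_ , found) with Any.satisfied found
  ...   | y' , z∈' with M.colour y' Bool.≟ M.colour y
  ...     | yes same = same
  ...     | no differ = ⊥-elim (N.disjoint (λ y≡y' → differ (cong M.colour (≡.sym y≡y'))) (z∈ , z∈'))

  colour : Z → Bool
  colour z = N.colour z xor hostColour z

  colour-on-branch : ∀ {x y z} → y ∈ M.branch x → z ∈ N.branch y → colour z ≡ N.colour z xor M.colour y
  colour-on-branch y∈ z∈ = cong (N.colour _ xor_) (hostColour-correct y∈ z∈)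

  recolouredTree : ∀ {x y} → y ∈ M.branch x → IsTree (bichromatic C colour) (N.branch y) (N.branchEdges y)
  recolouredTree {y = y} y∈ = IsTree-mono recolour (N.branchTree y)
    where
    recolour : ∀ {a b} → a ∈ N.branch y → b ∈ N.branch y →
               Adj (bichromatic C N.colour) a b → Adj (bichromatic C colour) a b
    recolour a∈ b∈ (adj , d) = adj , λ e → d (xor-cancelʳ (M.colour y)
      (≡.trans (≡.sym (colour-on-branch y∈ a∈)) (≡.trans e (colour-on-branch y∈ b∈))))

  ∈-concatMap-branch⁻ : ∀ {ys z} → z ∈ concatMap N.branch ys → ∃ λ y → y ∈ ys × z ∈ N.branch y
  ∈-concatMap-branch⁻ = find ∘ ∈-concatMap⁻ N.branch

  liftTree : ∀ {x ys es} → ys ⊆ M.branch x → IsTree (bichromatic B M.colour) ys es →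
             SpanningTree (bichromatic C colour) (concatMap N.branch ys)
  liftTree ys⊆ (single y) = SpanningTree-↭ (↭-reflexive (≡.sym (++-identityʳ _))) record
    { vertices = N.branch y ; edges = N.branchEdges y ; isTree = recolouredTree (ys⊆ (here refl))
    ; ↭-vertices = ↭-refl }
  liftTree ys⊆ (leaf {vs = ys} {u = y} {w = y'} T y∈ y'∉ (adj , d)) with N.oddEdge adj
  ... | monochromaticEdge {z} {z'} z∈ z'∈ adj' same =
    SpanningTree-join L (recolouredTree (ys⊆ (here refl))) disj
      (∈-concatMap⁺ N.branch (lose y∈ z∈)) z'∈ (adj' , colours-differ)
    where
    L = liftTree (ys⊆ ∘ there) T
    disj : Disjoint (concatMap N.branch ys) (N.branch y')
    disj (z∈L , z∈') with ∈-concatMap-branch⁻ z∈L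
    ... | y₀ , y₀∈ , z∈₀ = N.disjoint (λ y₀≡y' → y'∉ (subst (_∈ ys) y₀≡y' y₀∈)) (z∈₀ , z∈')
    colours-differ : colour z ≢ colour z'
    colours-differ e = d (xor-cancelˡ (N.colour z) (begin
      N.colour z xor M.colour y   ≡⟨ colour-on-branch (ys⊆ (there y∈)) z∈ ⟨
      colour z                    ≡⟨ e ⟩
      colour z'                   ≡⟨ colour-on-branch (ys⊆ (here refl)) z'∈ ⟩
      N.colour z' xor M.colour y' ≡⟨ cong (_xor M.colour y') same ⟨
      N.colour z xor M.colour y'  ∎))
      where open ≡.≡-Reasoning

  lifted : ∀ x → SpanningTree (bichromatic C colour) (concatMap N.branch (M.branch x))
  lifted x = liftTree {x = x} id (M.branchTree x)

  ∈-lifted⁺ : ∀ {x y z} → y ∈ M.branch x → z ∈ N.branch y → z ∈ vertices (lifted x)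
  ∈-lifted⁺ y∈ z∈ = ∈⁺ (lifted _) (∈-concatMap⁺ N.branch (lose y∈ z∈))

  model : OddModel A C
  model = record
    { colour      = colour
    ; branch      = vertices ∘ lifted
    ; branchEdges = edges ∘ lifted
    ; branchTree  = isTree ∘ lifted
    ; disjoint    = disjoint
    ; oddEdge     = oddEdge
    }
    where
    disjoint : ∀ {x x'} → x ≢ x' → Disjoint (vertices (lifted x)) (vertices (lifted x'))
    disjoint {x} {x'} x≢x' (z∈ , z∈')
      with ∈-concatMap-branch⁻ (∈⁻ (lifted x) z∈) | ∈-concatMap-branch⁻ (∈⁻ (lifted x') z∈')
    ... | y , y∈ , z∈y | y' , y'∈ , z∈y' =
      N.disjoint (λ y≡y' → M.disjoint x≢x' (y∈ , subst (_∈ M.branch x') (≡.sym y≡y') y'∈)) (z∈y , z∈y')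
    oddEdge : ∀ {x x'} → Adj A x x' → MonochromaticEdge C colour (vertices (lifted x)) (vertices (lifted x'))
    oddEdge a with M.oddEdge a
    ... | monochromaticEdge y∈ y'∈ b sameM with N.oddEdge b
    ...   | monochromaticEdge z∈ z'∈ c sameN =
      monochromaticEdge (∈-lifted⁺ y∈ z∈) (∈-lifted⁺ y'∈ z'∈) c
        (≡.trans (colour-on-branch y∈ z∈) (≡.trans (cong₂ _xor_ sameN sameM) (≡.sym (colour-on-branch y'∈ z'∈))))

OddModel-trans : ∀ {r} {Y Z : Set} {A : Graph (Fin r)} {B : Graph Y} {C : Graph Z} →
                 DecidableEquality Z → OddModel A B → OddModel B C → OddModel A C
OddModel-trans = Composite.model

cartesian⊆ : ∀ {V W : Set} {G : Graph V} {H : Graph W} (∗ : ProductKind) {a b} →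
             Adj (cartesian G H) a b → Adj (G ⟨ ∗ ⟩ H) a b
cartesian⊆ □   a              = a
cartesian⊆ lex (inj₁ (e , b)) = inj₂ (e , b)
cartesian⊆ lex (inj₂ (_ , a)) = inj₁ a
cartesian⊆ ⊠   a              = inj₁ a

module ProductModel {X X' V W : Set} {A : Graph X} {B : Graph X'} {G : Graph V} {H : Graph W}
                    (MG : OddModel A G) (MH : OddModel B H) where
  private
    module MG = OddModel MG
    module MH = OddModel MH

  colour : V × W → Bool
  colour (v , u) = MG.colour v xor MH.colour u

  fibre : ∀ v {us fs} → IsTree (bichromatic H MH.colour) us fs →
          IsTree (bichromatic (cartesian G H) colour) (map (v ,_) us) (map (Product.map (v ,_) (v ,_)) fs)
  fibre v = IsTree-map ,-injectiveʳ (λ (a , d) → inj₁ (refl , a) , d ∘ xor-cancelˡ (MG.colour v))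

  productTree : ∀ {vs es us fs} → IsTree (bichromatic G MG.colour) vs es → IsTree (bichromatic H MH.colour) us fs →
                SpanningTree (bichromatic (cartesian G H) colour) (cartesianProduct vs us)
  productTree (single v) T = record
    { vertices = _ ; edges = _ ; isTree = fibre v T ; ↭-vertices = ↭-reflexive (≡.sym (++-identityʳ _)) }
  productTree {us = us} (leaf {vs = vs} {w = w} S u∈ w∉ (a , d)) T =
    SpanningTree-join (productTree S T) (fibre w T) disj (∈-cartesianProduct⁺ u∈ r∈) (∈-map⁺ (w ,_) r∈)
      (inj₂ (refl , a) , d ∘ xor-cancelʳ (MH.colour r))
    where
    r = proj₁ (IsTree-nonempty T)
    r∈ = proj₂ (IsTree-nonempty T)
    disj : Disjoint (cartesianProduct vs us) (map (w ,_) us)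
    disj (z∈ , z∈w) with ∈-map⁻ (w ,_) z∈w
    ... | _ , _ , refl = w∉ (proj₁ (∈-cartesianProduct⁻ vs us z∈))

  tree : ∀ x y → SpanningTree (bichromatic (cartesian G H) colour) (cartesianProduct (MG.branch x) (MH.branch y))
  tree x y = productTree (MG.branchTree x) (MH.branchTree y)

  branch : X × X' → List (V × W)
  branch (x , y) = vertices (tree x y)

  ∈-branch⁺ : ∀ {x y v u} → v ∈ MG.branch x → u ∈ MH.branch y → (v , u) ∈ branch (x , y)
  ∈-branch⁺ v∈ u∈ = ∈⁺ (tree _ _) (∈-cartesianProduct⁺ v∈ u∈)

  ∈-branch⁻ : ∀ {x y v u} → (v , u) ∈ branch (x , y) → v ∈ MG.branch x × u ∈ MH.branch y
  ∈-branch⁻ {x} {y} vu∈ = ∈-cartesianProduct⁻ (MG.branch x) (MH.branch y) (∈⁻ (tree x y) vu∈)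

  disjoint : ∀ {p p'} → p ≢ p' → Disjoint (branch p) (branch p')
  disjoint {x , y} {x' , y'} p≢p' {v , u} (vu∈ , vu∈') with ∈-branch⁻ vu∈ | ∈-branch⁻ vu∈'
  ... | v∈ , u∈ | v∈' , u∈' =
    MG.disjoint (λ x≡x' → MH.disjoint (λ y≡y' → p≢p' (cong₂ _,_ x≡x' y≡y')) (u∈ , u∈')) (v∈ , v∈')

  cartesianEdge : ∀ {p p'} → Adj (cartesian A B) p p' → MonochromaticEdge (cartesian G H) colour (branch p) (branch p')
  cartesianEdge {x , _} (inj₁ (refl , b)) with MH.oddEdge b | IsTree-nonempty (MG.branchTree x)
  ... | monochromaticEdge u∈ u'∈ adj same | v , v∈ =
    monochromaticEdge (∈-branch⁺ v∈ u∈) (∈-branch⁺ v∈ u'∈) (inj₁ (refl , adj)) (cong (MG.colour v xor_) same)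
  cartesianEdge {_ , y} (inj₂ (refl , a)) with MG.oddEdge a | IsTree-nonempty (MH.branchTree y)
  ... | monochromaticEdge v∈ v'∈ adj same | u , u∈ =
    monochromaticEdge (∈-branch⁺ v∈ u∈) (∈-branch⁺ v'∈ u∈) (inj₂ (refl , adj)) (cong (_xor MH.colour u) same)

  diagonalEdge : ∀ {x x' y y'} → Adj A x x' → Adj B y y' →
                 MonochromaticEdge (strong G H) colour (branch (x , y)) (branch (x' , y'))
  diagonalEdge a b with MG.oddEdge a | MH.oddEdge b
  ... | monochromaticEdge v∈ v'∈ adjG sameG | monochromaticEdge u∈ u'∈ adjH sameH =
    monochromaticEdge (∈-branch⁺ v∈ u∈) (∈-branch⁺ v'∈ u'∈) (inj₂ (adjG , adjH)) (cong₂ _xor_ sameG sameH)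

  model : ∀ ∗ → (∀ {p p'} → Adj (A ⟨ ∗ ⟩ B) p p' → MonochromaticEdge (G ⟨ ∗ ⟩ H) colour (branch p) (branch p')) →
          OddModel (A ⟨ ∗ ⟩ B) (G ⟨ ∗ ⟩ H)
  model ∗ oddEdge = record
    { colour      = colour
    ; branch      = branch
    ; branchEdges = λ (x , y) → edges (tree x y)
    ; branchTree  = λ (x , y) → IsTree-mono (λ _ _ (a , d) → cartesian⊆ ∗ a , d) (isTree (tree x y))
    ; disjoint    = disjoint
    ; oddEdge     = oddEdge
    }

sameColouredPair : ∀ {t} {W : Set} {H : Graph W} (M : OddModel (K t) H) (j j' : Fin t) →
                   let open OddModel M in
                   ∃₂ λ u u' → u ∈ branch j × u' ∈ branch j' × colour u ≡ colour u'
sameColouredPair M j j' with j Fin.≟ j'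
... | yes refl = let u , u∈ = IsTree-nonempty (OddModel.branchTree M j) in u , u , u∈ , u∈ , refl
... | no j≢j'  = let monochromaticEdge u∈ u'∈ _ same = OddModel.oddEdge M j≢j' in _ , _ , u∈ , u'∈ , same

module _ {X X' V W : Set} {A : Graph X} {B : Graph X'} {G : Graph V} {H : Graph W} where

  cartesianModel : OddModel A G → OddModel B H → OddModel (cartesian A B) (cartesian G H)
  cartesianModel MG MH = model □ cartesianEdge
    where open ProductModel MG MH

  strongModel : OddModel A G → OddModel B H → OddModel (strong A B) (strong G H)
  strongModel MG MH = model ⊠ λ { (inj₁ a) → MonochromaticEdge-mono inj₁ (cartesianEdge a)
                                ; (inj₂ (a , b)) → diagonalEdge a b }
    where open ProductModel MG MH

lexicographicModel : ∀ {t} {X V W : Set} {A : Graph X} {G : Graph V} {H : Graph W} →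
                     OddModel A G → OddModel (K t) H → OddModel (lexicographic A (K t)) (lexicographic G H)
lexicographicModel {t} {A = A} {G} {H} MG MH = model lex oddEdge
  where
  open ProductModel MG MH
  oddEdge : ∀ {p p'} → Adj (lexicographic A (K t)) p p' →
            MonochromaticEdge (lexicographic G H) colour (branch p) (branch p')
  oddEdge {_ , j} {_ , j'} (inj₁ a) with OddModel.oddEdge MG a | sameColouredPair MH j j'
  ... | monochromaticEdge v∈ v'∈ adj same | _ , _ , u∈ , u'∈ , same' =
    monochromaticEdge (∈-branch⁺ v∈ u∈) (∈-branch⁺ v'∈ u'∈) (inj₁ adj) (cong₂ _xor_ same same')
  oddEdge (inj₂ b) = MonochromaticEdge-mono (cartesian⊆ {G = G} {H = H} lex) (cartesianEdge (inj₁ b))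

productModel : ∀ ∗ {s t} {V W : Set} {G : Graph V} {H : Graph W} →
               OddModel (K s) G → OddModel (K t) H → OddModel (K s ⟨ ∗ ⟩ K t) (G ⟨ ∗ ⟩ H)
productModel □   = cartesianModel
productModel lex = lexicographicModel
productModel ⊠   = strongModel

theorem1 : (∗ : ProductKind) (n p : ℕ) (G : Graph (Fin n)) (H : Graph (Fin p))
           (s t : ℕ) → IsOh G s → IsOh H t →
           ∀ r → IsOh (K s ⟨ ∗ ⟩ K t) r → OddMinorK (G ⟨ ∗ ⟩ H) r
theorem1 ∗ n p G H s t (MG , _) (MH , _) r (M , _) =
  OddModel⇒OddMinorK
    (OddModel-trans (≡-dec Fin._≟_ Fin._≟_) (OddMinorK⇒OddModel M)
      (productModel ∗ (OddMinorK⇒OddModel MG) (OddMinorK⇒OddModel MH)))
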